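{- Let $G$ be a forbidden induced subgraph for the class of apex cographs with $|V(G)|=9$. Then $V(G)$ has three distinct subsets $S,T,F$ such that each of $G[S]$, $G[T]$, $G[F]$ is isomorphic to the path $P_4$, and $|S\cap T|=|T\cap F|=|S\cap F|=1$.
   Context: All graphs are finite, simple and undirected; $G[X]$ is the subgraph induced on $X$, and $P_4$ is the path on four vertices. A cograph is a graph generated from $K_1$ by complementation and disjoint union; equivalently, a graph with no induced $P_4$. A graph $G$ is an apex cograph if it has a vertex $v$ with $G-v$ a cograph. A forbidden induced subgraph for apex cographs is a graph that is not an apex cograph but all of whose proper induced subgraphs are apex cographs. -}

module Defs where

open import Data.Bool using (Bool; true; false; _∨_)
open import Data.Nat using (ℕ; suc; _≡ᵇ_)
open import Data.Fin using (Fin; zero; suc; toℕ)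
open import Data.Product using (Σ; ∃; _×_; _,_)
open import Data.Sum using (_⊎_)
open import Relation.Nullary using (¬_)
open import Relation.Binary.PropositionalEquality using (_≡_; _≢_; refl)
open import Function.Definitions using (Injective; Bijective)
open import Data.Fin.Subset using (Subset; _∈_; _∉_)

record Graph (V : Set) : Set where
  field
    adj    : V → V → Bool
    sym    : ∀ u v → adj u v ≡ adj v u
    irrefl : ∀ v → adj v v ≡ false
open Graph public

induced : {V : Set} → Graph V → (P : V → Set) → Graph (Σ V P)
induced G P = record
  { adj    = λ { (u , _) (v , _) → adj G u v }
  ; sym    = λ { (u , _) (v , _) → sym G u v }
  ; irrefl = λ { (v , _) → irrefl G v } }

sub : {n : ℕ} → Graph (Fin n) → (X : Subset n) → Graph (Σ (Fin n) (λ v → v ∈ X))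
sub G X = induced G (λ v → v ∈ X)

delete : {V : Set} → Graph V → (v : V) → Graph (Σ V (λ u → u ≢ v))
delete G v = induced G (λ u → u ≢ v)

p4adj : Fin 4 → Fin 4 → Bool
p4adj i j = (suc (toℕ i) ≡ᵇ toℕ j) ∨ (suc (toℕ j) ≡ᵇ toℕ i)

P4 : Graph (Fin 4)
P4 = record { adj = p4adj ; sym = s ; irrefl = r }
  where
  s : ∀ u v → p4adj u v ≡ p4adj v u
  s zero zero = refl
  s zero (suc zero) = refl
  s zero (suc (suc zero)) = refl
  s zero (suc (suc (suc zero))) = refl
  s (suc zero) zero = refl
  s (suc zero) (suc zero) = refl
  s (suc zero) (suc (suc zero)) = refl
  s (suc zero) (suc (suc (suc zero))) = refl
  s (suc (suc zero)) zero = refl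
  s (suc (suc zero)) (suc zero) = refl
  s (suc (suc zero)) (suc (suc zero)) = refl
  s (suc (suc zero)) (suc (suc (suc zero))) = refl
  s (suc (suc (suc zero))) zero = refl
  s (suc (suc (suc zero))) (suc zero) = refl
  s (suc (suc (suc zero))) (suc (suc zero)) = refl
  s (suc (suc (suc zero))) (suc (suc (suc zero))) = refl
  r : ∀ v → p4adj v v ≡ false
  r zero = refl
  r (suc zero) = refl
  r (suc (suc zero)) = refl
  r (suc (suc (suc zero))) = refl

_≅_ : {V W : Set} → Graph V → Graph W → Set
_≅_ {V} {W} G H = Σ (V → W) λ f →
  Bijective _≡_ _≡_ f × (∀ u v → adj H (f u) (f v) ≡ adj G u v)

-- G contains an induced P4: an injective map from P4 that is an isomorphism
-- onto its image (i.e. some induced subgraph is isomorphic to P4).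
HasInducedP4 : {V : Set} → Graph V → Set
HasInducedP4 {V} G = Σ (Fin 4 → V) λ f →
  Injective _≡_ _≡_ f × (∀ i j → adj G (f i) (f j) ≡ p4adj i j)

IsCograph : {V : Set} → Graph V → Set
IsCograph G = ¬ HasInducedP4 G

-- Apex cograph: some vertex v with G - v a cograph.  A cograph counts as an
-- apex cograph (this also covers the null graph, which has no vertex).
IsApexCograph : {V : Set} → Graph V → Set
IsApexCograph {V} G = IsCograph G ⊎ Σ V (λ v → IsCograph (delete G v))

IsForbiddenApexCograph : {n : ℕ} → Graph (Fin n) → Set
IsForbiddenApexCograph {n} G =
  ¬ IsApexCograph G ×
  (∀ (X : Subset n) → Σ (Fin n) (λ v → v ∉ X) → IsApexCograph (sub G X))

-- Each vertex v of G is avoided by an induced P4, since G − v is not a cograph, so the vertex sets of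
-- these P4s have no common element; shrink this family to a critical one, whose intersection is empty
-- while every subfamily omitting one member still meets. By minimality of G the union of any family
-- of induced P4s without common vertex is all of V(G): the proper induced subgraph it would otherwise
-- span contains a P4, and for each of its vertices a P4 avoiding it. Double counting memberships over
-- the vertices of a critical family of k four-element sets gives (k − 2)·k + |⋃| ≤ 4k, and |⋃| = 9
-- forces k = 3 with pairwise intersections of size one.
module Submission where

open import Data.Bool as Bool using (Bool; true; false; _∧_; _∨_; T)
open import Data.Bool.ListAction using (and; or)
open import Data.Empty using (⊥-elim)
open import Data.Fin using (Fin; zero; suc; _≟_)
open import Data.Fin.Properties using (any?; all?)
open import Data.Fin.Subset
  using (Subset; _∩_; _∪_; ∣_∣; ⊤; ⊥; ⁅_⁆; ⋃; ⋂; _∈_; _∉_; _⊆_; Nonempty; Empty)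
open import Data.Fin.Subset.Properties
  using (_∈?_; nonempty?; ∈⊤; ∉⊥; x∈⁅x⁆; x∈⁅y⁆⇒x≡y; ∣⁅x⁆∣≡1; ∣⊥∣≡0; ∣⊤∣≡n;
         x∈p∩q⁺; x∈p∩q⁻; x∈p∪q⁺; x∈p∪q⁻; p⊆p∪q; q⊆p∪q; p⊆q⇒∣p∣≤∣q∣;
         x∈p⇒∣p-x∣<∣p∣; ∩-identityʳ)
open import Data.List as List using (List; []; _∷_; map; length)
open import Data.List.Properties using (map-∘; map-cong; length-map)
open import Data.List.Relation.Unary.All as All using (All; []; _∷_)
import Data.List.Relation.Unary.All.Properties as All
import Data.List.Relation.Unary.Any as Any
open import Data.Nat using (ℕ; zero; suc; _+_; _*_; _∸_; _≤_; _<_; _≡ᵇ_; z≤n; s≤s)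
open import Data.Nat.Induction using (<-wellFounded)
open import Data.Nat.ListAction using (sum)
open import Data.Nat.Properties
  using (+-*-semiring; +-identityʳ; *-identityˡ; *-identityʳ; *-zeroʳ; +-comm; +-assoc;
         m∸n≤m; m≤n⇒m≤1+n; m≤m+n; n<1+n; ≡ᵇ⇒≡; _≤?_; <⇒≱;
         ≤-refl; ≤-reflexive; ≤-trans; ≤-antisym;
         +-mono-≤; +-monoˡ-≤; +-monoʳ-≤; *-monoʳ-≤; +-cancelʳ-≤; module ≤-Reasoning)
open import Algebra.Properties.Semiring.Sum +-*-semiring
  using (sum-syntax; ∑-distrib-+; *-distribˡ-sum; sum-replicate-zero)
open import Data.Product as Product using (Σ; ∃; _×_; _,_; proj₁; proj₂)
open import Data.Sum using (_⊎_; inj₁; inj₂; [_,_]′)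
open import Data.Unit using (tt)
open import Data.Vec using ([]; _∷_; lookup)
open import Data.Vec.Properties using (lookup-zipWith; lookup-replicate; lookup⇒[]=)
open import Data.Vec.Properties.WithK using ([]=-irrelevant)
import Data.Vec.Functional as Vector
open import Defs hiding (sym)
open import Function using (_∘_; id)
open import Function.Definitions using (Injective; Surjective)
open import Induction.WellFounded using (Acc; acc)
open import Relation.Binary.PropositionalEquality
  using (_≡_; _≢_; refl; sym; trans; cong; cong₂; subst; _≗_; module ≡-Reasoning)
open import Relation.Nullary using (Dec; yes; no; ¬_; ¬?; contradiction)
open import Relation.Nullary.Decidable
  using (_×-dec_; _⊎-dec_; map′; decidable-stable; toWitness; from-no)
open import Relation.Unary using (Decidable)

private
  variable
    A B : Set
    m n : ℕ

toℕ : Bool → ℕ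
toℕ false = 0
toℕ true  = 1

toℕ≤1 : ∀ b → toℕ b ≤ 1
toℕ≤1 false = z≤n
toℕ≤1 true  = ≤-refl

countTrue : List Bool → ℕ
countTrue bs = sum (map toℕ bs)

omitEach : List A → List (List A)
omitEach []       = []
omitEach (x ∷ xs) = xs ∷ map (x ∷_) (omitEach xs)

length-omitEach : (xs : List A) → length (omitEach xs) ≡ length xs
length-omitEach []       = refl
length-omitEach (x ∷ xs) = cong suc (trans (length-map (x ∷_) (omitEach xs)) (length-omitEach xs))

omitEach-shorter : (xs : List A) → All (λ ys → suc (length ys) ≡ length xs) (omitEach xs)
omitEach-shorter []       = []
omitEach-shorter (x ∷ xs) = refl ∷ All.map⁺ (All.map (cong suc) (omitEach-shorter xs))

map-omitEach : (f : A → B) (xs : List A) → omitEach (map f xs) ≡ map (map f) (omitEach xs)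
map-omitEach f []       = refl
map-omitEach f (x ∷ xs) = cong (map f xs ∷_) (begin
  map (f x ∷_) (omitEach (map f xs))            ≡⟨ cong (map (f x ∷_)) (map-omitEach f xs) ⟩
  map (f x ∷_) (map (map f) (omitEach xs))      ≡⟨ map-∘ (omitEach xs) ⟨
  map (λ ys → map f (x ∷ ys)) (omitEach xs)     ≡⟨ map-∘ (omitEach xs) ⟩
  map (map f) (map (x ∷_) (omitEach xs))        ∎)
  where open ≡-Reasoning

countTrue≤length : (bs : List Bool) → countTrue bs ≤ length bs
countTrue≤length []           = z≤n
countTrue≤length (true ∷ bs)  = s≤s (countTrue≤length bs)
countTrue≤length (false ∷ bs) = m≤n⇒m≤1+n (countTrue≤length bs)

toℕ-or≤countTrue : (bs : List Bool) → toℕ (or bs) ≤ countTrue bs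
toℕ-or≤countTrue []           = z≤n
toℕ-or≤countTrue (true ∷ bs)  = s≤s z≤n
toℕ-or≤countTrue (false ∷ bs) = toℕ-or≤countTrue bs

≤⇒≡ᵇsuc-false : m ≤ n → (m ≡ᵇ suc n) ≡ false
≤⇒≡ᵇsuc-false z≤n     = refl
≤⇒≡ᵇsuc-false (s≤s p) = ≤⇒≡ᵇsuc-false p

and≡countTrue≡ᵇlength : (bs : List Bool) → and bs ≡ (countTrue bs ≡ᵇ length bs)
and≡countTrue≡ᵇlength []           = refl
and≡countTrue≡ᵇlength (true ∷ bs)  = and≡countTrue≡ᵇlength bs
and≡countTrue≡ᵇlength (false ∷ bs) = sym (≤⇒≡ᵇsuc-false (countTrue≤length bs))

countTrue-and-false∷ : (bss : List (List Bool)) → countTrue (map and (map (false ∷_) bss)) ≡ 0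
countTrue-and-false∷ []        = refl
countTrue-and-false∷ (_ ∷ bss) = countTrue-and-false∷ bss

-- An omission can only be all true by removing the unique false entry.
countTrue-omitEach : (bs : List Bool) → and bs ≡ false →
  countTrue (map and (omitEach bs)) ≡ toℕ (suc (countTrue bs) ≡ᵇ length bs)
countTrue-omitEach (false ∷ bs) _ = begin
  toℕ (and bs) + countTrue (map and (map (false ∷_) (omitEach bs)))
    ≡⟨ cong (toℕ (and bs) +_) (countTrue-and-false∷ (omitEach bs)) ⟩
  toℕ (and bs) + 0
    ≡⟨ +-identityʳ _ ⟩
  toℕ (and bs)
    ≡⟨ cong toℕ (and≡countTrue≡ᵇlength bs) ⟩
  toℕ (countTrue bs ≡ᵇ length bs) ∎
  where open ≡-Reasoning
countTrue-omitEach (true ∷ bs) and≡false = begin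
  toℕ (and bs) + countTrue (map and (map (true ∷_) (omitEach bs)))
    ≡⟨ cong₂ _+_ (cong toℕ and≡false) (cong countTrue (sym (map-∘ (omitEach bs)))) ⟩
  countTrue (map and (omitEach bs))
    ≡⟨ countTrue-omitEach bs and≡false ⟩
  toℕ (suc (countTrue bs) ≡ᵇ length bs) ∎
  where open ≡-Reasoning

indicator-bound : ∀ {o} l c → o ≤ 1 → o ≤ c → (l ∸ 2) * toℕ (suc c ≡ᵇ l) + o ≤ c
indicator-bound l c o≤1 o≤c with suc c ≡ᵇ l in c+1≡ᵇl
... | false rewrite *-zeroʳ (l ∸ 2) = o≤c
... | true with ≡ᵇ⇒≡ (suc c) l (subst T (sym c+1≡ᵇl) tt)
...   | refl rewrite *-identityʳ (c ∸ 1) = pred+≤ c o≤1 o≤c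
  where
  pred+≤ : ∀ {b} c → b ≤ 1 → b ≤ c → c ∸ 1 + b ≤ c
  pred+≤ c       z≤n       _ = ≤-trans (≤-reflexive (+-identityʳ (c ∸ 1))) (m∸n≤m c 1)
  pred+≤ (suc c) (s≤s z≤n) _ = ≤-reflexive (+-comm c 1)

omitEach-bound : (bs : List Bool) → and bs ≡ false →
  (length bs ∸ 2) * countTrue (map and (omitEach bs)) + toℕ (or bs) ≤ countTrue bs
omitEach-bound bs and≡false = begin
  (length bs ∸ 2) * countTrue (map and (omitEach bs)) + toℕ (or bs)
    ≡⟨ cong (λ d → (length bs ∸ 2) * d + toℕ (or bs)) (countTrue-omitEach bs and≡false) ⟩
  (length bs ∸ 2) * toℕ (suc (countTrue bs) ≡ᵇ length bs) + toℕ (or bs)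
    ≤⟨ indicator-bound (length bs) (countTrue bs) (toℕ≤1 (or bs)) (toℕ-or≤countTrue bs) ⟩
  countTrue bs ∎
  where open ≤-Reasoning

∑-mono-≤ : {f g : Fin n → ℕ} → (∀ i → f i ≤ g i) → ∑[ i < n ] f i ≤ ∑[ i < n ] g i
∑-mono-≤ {zero}  f≤g = z≤n
∑-mono-≤ {suc n} f≤g = +-mono-≤ (f≤g zero) (∑-mono-≤ (f≤g ∘ suc))

∣p∣≡∑ : (p : Subset n) → ∣ p ∣ ≡ ∑[ v < n ] toℕ (lookup p v)
∣p∣≡∑ []          = refl
∣p∣≡∑ (true ∷ p)  = cong suc (∣p∣≡∑ p)
∣p∣≡∑ (false ∷ p) = ∣p∣≡∑ p

∣p∪q∣≤∣p∣+∣q∣ : (p q : Subset n) → ∣ p ∪ q ∣ ≤ ∣ p ∣ + ∣ q ∣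
∣p∪q∣≤∣p∣+∣q∣ {n} p q = begin
  ∣ p ∪ q ∣
    ≡⟨ ∣p∣≡∑ (p ∪ q) ⟩
  ∑[ v < n ] toℕ (lookup (p ∪ q) v)
    ≤⟨ ∑-mono-≤ pointwise ⟩
  ∑[ v < n ] (toℕ (lookup p v) + toℕ (lookup q v))
    ≡⟨ ∑-distrib-+ (toℕ ∘ lookup p) (toℕ ∘ lookup q) ⟩
  ∑[ v < n ] toℕ (lookup p v) + ∑[ v < n ] toℕ (lookup q v)
    ≡⟨ cong₂ _+_ (∣p∣≡∑ p) (∣p∣≡∑ q) ⟨
  ∣ p ∣ + ∣ q ∣ ∎
  where
  open ≤-Reasoning
  toℕ-∨ : ∀ a b → toℕ (a ∨ b) ≤ toℕ a + toℕ b
  toℕ-∨ true  _ = s≤s z≤n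
  toℕ-∨ false _ = ≤-refl
  pointwise : ∀ v → toℕ (lookup (p ∪ q) v) ≤ toℕ (lookup p v) + toℕ (lookup q v)
  pointwise v rewrite lookup-zipWith _∨_ v p q = toℕ-∨ (lookup p v) (lookup q v)

column : Fin n → List (Subset n) → List Bool
column v = map (λ p → lookup p v)

lookup-⋂ : (ps : List (Subset n)) (v : Fin n) → lookup (⋂ ps) v ≡ and (column v ps)
lookup-⋂ []       v = lookup-replicate v true
lookup-⋂ (p ∷ ps) v = trans (lookup-zipWith _∧_ v p (⋂ ps)) (cong (lookup p v ∧_) (lookup-⋂ ps v))

lookup-⋃ : (ps : List (Subset n)) (v : Fin n) → lookup (⋃ ps) v ≡ or (column v ps)
lookup-⋃ []       v = lookup-replicate v false
lookup-⋃ (p ∷ ps) v = trans (lookup-zipWith _∨_ v p (⋃ ps)) (cong (lookup p v ∨_) (lookup-⋃ ps v))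

column-⋂-omitEach : (v : Fin n) (ps : List (Subset n)) →
  column v (map ⋂ (omitEach ps)) ≡ map and (omitEach (column v ps))
column-⋂-omitEach v ps = begin
  column v (map ⋂ (omitEach ps))                ≡⟨ map-∘ (omitEach ps) ⟨
  map (λ qs → lookup (⋂ qs) v) (omitEach ps)    ≡⟨ map-cong (λ qs → lookup-⋂ qs v) (omitEach ps) ⟩
  map (and ∘ column v) (omitEach ps)            ≡⟨ map-∘ (omitEach ps) ⟩
  map and (map (column v) (omitEach ps))        ≡⟨ cong (map and) (map-omitEach _ ps) ⟨
  map and (omitEach (column v ps))              ∎
  where open ≡-Reasoning

totalSize : List (Subset n) → ℕ
totalSize ps = sum (map ∣_∣ ps)

totalSize≡∑ : (ps : List (Subset n)) → totalSize ps ≡ ∑[ v < n ] countTrue (column v ps)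
totalSize≡∑ {n} []       = sym (sum-replicate-zero n)
totalSize≡∑     (p ∷ ps) =
  trans (cong₂ _+_ (∣p∣≡∑ p) (totalSize≡∑ ps))
        (sym (∑-distrib-+ (toℕ ∘ lookup p) (λ v → countTrue (column v ps))))

empty-⋂⇒and-false : (ps : List (Subset n)) → Empty (⋂ ps) → ∀ v → and (column v ps) ≡ false
empty-⋂⇒and-false ps empty v with and (column v ps) in all-true
... | false = refl
... | true  = ⊥-elim (empty (v , lookup⇒[]= v (⋂ ps) (trans (lookup-⋂ ps v) all-true)))

family-count : (ps : List (Subset n)) → Empty (⋂ ps) →
  (length ps ∸ 2) * totalSize (map ⋂ (omitEach ps)) + ∣ ⋃ ps ∣ ≤ totalSize ps
family-count {n} ps empty = begin
  k * totalSize (map ⋂ (omitEach ps)) + ∣ ⋃ ps ∣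
    ≡⟨ cong₂ _+_ (cong (k *_) (totalSize≡∑ (map ⋂ (omitEach ps)))) (∣p∣≡∑ (⋃ ps)) ⟩
  k * ∑[ v < n ] omitted v + ∑[ v < n ] toℕ (lookup (⋃ ps) v)
    ≡⟨ cong (_+ ∑[ v < n ] toℕ (lookup (⋃ ps) v)) (*-distribˡ-sum k omitted) ⟩
  ∑[ v < n ] (k * omitted v) + ∑[ v < n ] toℕ (lookup (⋃ ps) v)
    ≡⟨ ∑-distrib-+ (λ v → k * omitted v) (toℕ ∘ lookup (⋃ ps)) ⟨
  ∑[ v < n ] (k * omitted v + toℕ (lookup (⋃ ps) v))
    ≤⟨ ∑-mono-≤ pointwise ⟩
  ∑[ v < n ] countTrue (column v ps)
    ≡⟨ totalSize≡∑ ps ⟨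
  totalSize ps ∎
  where
  open ≤-Reasoning
  k = length ps ∸ 2
  omitted : Fin n → ℕ
  omitted v = countTrue (column v (map ⋂ (omitEach ps)))
  pointwise : ∀ v → k * omitted v + toℕ (lookup (⋃ ps) v) ≤ countTrue (column v ps)
  pointwise v = begin
    k * omitted v + toℕ (lookup (⋃ ps) v)
      ≡⟨ cong₂ _+_ (cong₂ (λ l d → (l ∸ 2) * countTrue d)
                          (sym (length-map _ ps)) (column-⋂-omitEach v ps))
                   (cong toℕ (lookup-⋃ ps v)) ⟩
    (length (column v ps) ∸ 2) * countTrue (map and (omitEach (column v ps))) + toℕ (or (column v ps))
      ≤⟨ omitEach-bound (column v ps) (empty-⋂⇒and-false ps empty v) ⟩
    countTrue (column v ps) ∎

Critical : List (Subset n) → Set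
Critical ps = Empty (⋂ ps) × All Nonempty (map ⋂ (omitEach ps))

critical-subfamily : (σ : A → Subset n) (xs : List A) → Empty (⋂ (map σ xs)) →
  ∃ λ ys → Critical (map σ ys)
critical-subfamily {A = A} σ xs = shrink xs (<-wellFounded (length xs))
  where
  shrink : (xs : List A) → Acc _<_ (length xs) → Empty (⋂ (map σ xs)) → ∃ λ ys → Critical (map σ ys)
  shrink xs (acc smaller) empty
    with Any.any? (λ ys → ¬? (nonempty? (⋂ (map σ ys)))) (omitEach xs)
  ... | yes some-empty =
    let shorter , empty′ = All.lookupAny (omitEach-shorter xs) some-empty
    in  shrink (Any.lookup some-empty) (smaller (≤-reflexive shorter)) empty′
  ... | no none-empty = xs , empty , subst (All Nonempty ∘ map ⋂) (sym (map-omitEach σ xs)) meets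
    where
    meets : All Nonempty (map ⋂ (map (map σ) (omitEach xs)))
    meets = All.map⁺ (All.map⁺ (All.map (decidable-stable (nonempty? _)) (All.¬Any⇒All¬ _ none-empty)))

nonempty⇒1≤∣p∣ : {p : Subset n} → Nonempty p → 1 ≤ ∣ p ∣
nonempty⇒1≤∣p∣ (_ , x∈p) = ≤-trans (s≤s z≤n) (x∈p⇒∣p-x∣<∣p∣ x∈p)

length≤totalSize : {ps : List (Subset n)} → All Nonempty ps → length ps ≤ totalSize ps
length≤totalSize []             = z≤n
length≤totalSize (nonempty ∷ ne) = +-mono-≤ (nonempty⇒1≤∣p∣ nonempty) (length≤totalSize ne)

totalSize≤ : ∀ {r} {ps : List (Subset n)} → All (λ p → ∣ p ∣ ≤ r) ps → totalSize ps ≤ length ps * r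
totalSize≤ []             = z≤n
totalSize≤ (small ∷ smalls) = +-mono-≤ small (totalSize≤ smalls)

quadratic-bound⇒≡3 : ∀ k → (k ∸ 2) * k + 9 ≤ k * 4 → k ≡ 3
quadratic-bound⇒≡3 0 h = contradiction h (from-no (9 ≤? 0))
quadratic-bound⇒≡3 1 h = contradiction h (from-no (9 ≤? 4))
quadratic-bound⇒≡3 2 h = contradiction h (from-no (9 ≤? 8))
quadratic-bound⇒≡3 3 _ = refl
quadratic-bound⇒≡3 (suc (suc (suc (suc j)))) h = contradiction h (<⇒≱ (begin-strict
  (4 + j) * 4            <⟨ n<1+n _ ⟩
  17 + j * 4             ≡⟨ cong (8 +_) (+-comm 9 (j * 4)) ⟩
  (2 + j) * 4 + 9        ≤⟨ +-monoˡ-≤ 9 (*-monoʳ-≤ (2 + j) (m≤m+n 4 j)) ⟩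
  (2 + j) * (4 + j) + 9  ∎))
  where open ≤-Reasoning

critical-length : {ps : List (Subset n)} → Critical ps →
  All (λ p → ∣ p ∣ ≤ 4) ps → 9 ≤ ∣ ⋃ ps ∣ → length ps ≡ 3
critical-length {ps = ps} (empty , meets) small covers = quadratic-bound⇒≡3 k (begin
  (k ∸ 2) * k + 9                                        ≤⟨ +-mono-≤ (*-monoʳ-≤ (k ∸ 2) k≤omitted) covers ⟩
  (k ∸ 2) * totalSize (map ⋂ (omitEach ps)) + ∣ ⋃ ps ∣  ≤⟨ family-count ps empty ⟩
  totalSize ps                                           ≤⟨ totalSize≤ small ⟩
  k * 4                                                  ∎)
  where
  open ≤-Reasoning
  k = length ps
  k≤omitted : k ≤ totalSize (map ⋂ (omitEach ps))
  k≤omitted = ≤-trans (≤-reflexive (sym (trans (length-map ⋂ (omitEach ps)) (length-omitEach ps))))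
                      (length≤totalSize meets)

three-positives-summing-to-3 : ∀ {x y z} → 1 ≤ x → 1 ≤ y → 1 ≤ z → x + (y + z) ≤ 3 →
  x ≡ 1 × y ≡ 1 × z ≡ 1
three-positives-summing-to-3 {x} {y} {z} 1≤x 1≤y 1≤z sum≤3 =
  first 1≤x 1≤y 1≤z sum≤3 ,
  first 1≤y 1≤x 1≤z (≤-trans (≤-reflexive y-first) sum≤3) ,
  first 1≤z 1≤x 1≤y (≤-trans (≤-reflexive z-first) sum≤3)
  where
  first : ∀ {a b c} → 1 ≤ a → 1 ≤ b → 1 ≤ c → a + (b + c) ≤ 3 → a ≡ 1
  first {a} 1≤a 1≤b 1≤c a+b+c≤3 =
    ≤-antisym (+-cancelʳ-≤ 2 a 1 (≤-trans (+-monoʳ-≤ a (+-mono-≤ 1≤b 1≤c)) a+b+c≤3)) 1≤a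
  y-first : y + (x + z) ≡ x + (y + z)
  y-first = trans (sym (+-assoc y x z)) (trans (cong (_+ z) (+-comm y x)) (+-assoc x y z))
  z-first : z + (x + y) ≡ x + (y + z)
  z-first = trans (+-comm z (x + y)) (+-assoc x y z)

∣p∩q∩⊤∣ : (p q : Subset n) → ∣ p ∩ (q ∩ ⊤) ∣ ≡ ∣ p ∩ q ∣
∣p∩q∩⊤∣ p q = cong (λ r → ∣ p ∩ r ∣) (∩-identityʳ q)

critical-triple : ∀ {A B C : Subset n} → Critical (A ∷ B ∷ C ∷ []) →
  All (λ p → ∣ p ∣ ≤ 4) (A ∷ B ∷ C ∷ []) → 9 ≤ ∣ ⋃ (A ∷ B ∷ C ∷ []) ∣ →
  ∣ A ∩ B ∣ ≡ 1 × ∣ B ∩ C ∣ ≡ 1 × ∣ A ∩ C ∣ ≡ 1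
critical-triple {A = A} {B} {C} (empty , meetBC ∷ meetAC ∷ meetAB ∷ []) small covers =
  let BC≡1 , AC≡1 , AB≡1 = three-positives-summing-to-3 (positive meetBC (∣p∩q∩⊤∣ B C))
                             (positive meetAC (∣p∩q∩⊤∣ A C)) (positive meetAB (∣p∩q∩⊤∣ A B)) sum≤3
  in  AB≡1 , BC≡1 , AC≡1
  where
  open ≤-Reasoning
  positive : ∀ {p x} → Nonempty p → ∣ p ∣ ≡ x → 1 ≤ x
  positive nonempty refl = nonempty⇒1≤∣p∣ nonempty
  omitted-sizes : 1 * totalSize (map ⋂ (omitEach (A ∷ B ∷ C ∷ [])))
                ≡ ∣ B ∩ C ∣ + (∣ A ∩ C ∣ + ∣ A ∩ B ∣)
  omitted-sizes = trans (*-identityˡ _)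
    (cong₂ _+_ (∣p∩q∩⊤∣ B C) (cong₂ _+_ (∣p∩q∩⊤∣ A C) (trans (+-identityʳ _) (∣p∩q∩⊤∣ A B))))
  sum≤3 : ∣ B ∩ C ∣ + (∣ A ∩ C ∣ + ∣ A ∩ B ∣) ≤ 3
  sum≤3 = +-cancelʳ-≤ 9 _ 3 (begin
    ∣ B ∩ C ∣ + (∣ A ∩ C ∣ + ∣ A ∩ B ∣) + 9
      ≡⟨ cong (_+ 9) omitted-sizes ⟨
    1 * totalSize (map ⋂ (omitEach (A ∷ B ∷ C ∷ []))) + 9
      ≤⟨ +-monoʳ-≤ _ covers ⟩
    1 * totalSize (map ⋂ (omitEach (A ∷ B ∷ C ∷ []))) + ∣ ⋃ (A ∷ B ∷ C ∷ []) ∣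
      ≤⟨ family-count (A ∷ B ∷ C ∷ []) empty ⟩
    totalSize (A ∷ B ∷ C ∷ [])
      ≤⟨ totalSize≤ small ⟩
    12 ∎)

critical-distinct : ∀ {A B C : Subset n} → Critical (A ∷ B ∷ C ∷ []) → A ≢ B × B ≢ C × A ≢ C
critical-distinct {A = A} {B} {C} (empty , (x , x∈B∩C) ∷ (y , y∈A∩C) ∷ (z , z∈A∩B) ∷ []) =
  (λ { refl → empty (y , x∈p∩q⁺ (first y∈A∩C , y∈A∩C)) }) ,
  (λ { refl → let z∈B∩⊤ = second z∈A∩B
              in  empty (z , x∈p∩q⁺ (first z∈A∩B , x∈p∩q⁺ (first z∈B∩⊤ , z∈B∩⊤))) }) ,
  (λ { refl → empty (x , x∈p∩q⁺ (first (second x∈B∩C) , x∈B∩C)) })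
  where
  first : ∀ {v} {p q : Subset n} → v ∈ p ∩ q → v ∈ p
  first = proj₁ ∘ x∈p∩q⁻ _ _
  second : ∀ {v} {p q : Subset n} → v ∈ p ∩ q → v ∈ q
  second = proj₂ ∘ x∈p∩q⁻ _ _

record InducedP4 {V : Set} (G : Graph V) : Set where
  field
    vertex     : Fin 4 → V
    adj-vertex : ∀ i j → adj G (vertex i) (vertex j) ≡ p4adj i j
open InducedP4

p4-twin-free : ∀ i j → i ≡ j ⊎ ∃ λ k → p4adj i k ≢ p4adj j k
p4-twin-free = toWitness
  {a? = all? λ i → all? λ j → (i ≟ j) ⊎-dec any? λ k → ¬? (p4adj i k Bool.≟ p4adj j k)} tt

module _ {V : Set} {G : Graph V} where

  vertex-injective : (c : InducedP4 G) → Injective _≡_ _≡_ (vertex c)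
  vertex-injective c {i} {j} same with p4-twin-free i j
  ... | inj₁ i≡j         = i≡j
  ... | inj₂ (k , differ) = contradiction (begin
    p4adj i k                     ≡⟨ adj-vertex c i k ⟨
    adj G (vertex c i) (vertex c k) ≡⟨ cong (λ v → adj G v (vertex c k)) same ⟩
    adj G (vertex c j) (vertex c k) ≡⟨ adj-vertex c j k ⟩
    p4adj j k                     ∎) differ
    where open ≡-Reasoning

  toHasInducedP4 : InducedP4 G → HasInducedP4 G
  toHasInducedP4 c = vertex c , vertex-injective c , adj-vertex c

  restrict : {P : V → Set} (c : InducedP4 G) → (∀ i → P (vertex c i)) → InducedP4 (induced G P)
  restrict c inside = record { vertex = λ i → vertex c i , inside i ; adj-vertex = adj-vertex c }

  unrestrict : {P : V → Set} → HasInducedP4 (induced G P) → Σ (InducedP4 G) λ c → ∀ i → P (vertex c i)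
  unrestrict (f , _ , adj-f) = record { vertex = proj₁ ∘ f ; adj-vertex = adj-f } , proj₂ ∘ f

image : (Fin m → Fin n) → Subset n
image {zero}  e = ⊥
image {suc m} e = ⁅ e zero ⁆ ∪ image (e ∘ suc)

∈-image : (e : Fin m → Fin n) (i : Fin m) → e i ∈ image e
∈-image e zero    = x∈p∪q⁺ (inj₁ (x∈⁅x⁆ (e zero)))
∈-image e (suc i) = x∈p∪q⁺ (inj₂ (∈-image (e ∘ suc) i))

∈-image⁻ : (e : Fin m → Fin n) {v : Fin n} → v ∈ image e → ∃ λ i → e i ≡ v
∈-image⁻ {zero}  e v∈ = contradiction v∈ ∉⊥
∈-image⁻ {suc m} e v∈ with x∈p∪q⁻ ⁅ e zero ⁆ (image (e ∘ suc)) v∈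
... | inj₁ v∈⁅e0⁆  = zero , sym (x∈⁅y⁆⇒x≡y (e zero) v∈⁅e0⁆)
... | inj₂ v∈image = Product.map suc id (∈-image⁻ (e ∘ suc) v∈image)

∣image∣≤ : (e : Fin m → Fin n) → ∣ image e ∣ ≤ m
∣image∣≤ {zero} {n} e = ≤-reflexive (∣⊥∣≡0 n)
∣image∣≤ {suc m}    e = ≤-trans (∣p∪q∣≤∣p∣+∣q∣ ⁅ e zero ⁆ (image (e ∘ suc)))
  (+-mono-≤ (≤-reflexive (∣⁅x⁆∣≡1 (e zero))) (∣image∣≤ (e ∘ suc)))

∃-map? : {P : (Fin m → Fin n) → Set} → (∀ {f g} → f ≗ g → P f → P g) → Decidable P → Dec (∃ P)
∃-map? {zero} {n} resp P? = map′ (λ p → empty-map , p) (λ (f , p) → resp (λ ()) p) (P? empty-map)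
  where
  empty-map : Fin 0 → Fin n
  empty-map ()
∃-map? {suc m} resp P? =
  map′ (λ (x , f , p) → x Vector.∷ f , p)
       (λ (f , p) → f zero , f ∘ suc , resp (λ { zero → refl ; (suc i) → refl }) p)
       (any? λ x → ∃-map? (λ f≗g → resp (λ { zero → refl ; (suc i) → f≗g i }))
                           (λ f → P? (x Vector.∷ f)))

module _ {G : Graph (Fin n)} where

  vertices : InducedP4 G → Subset n
  vertices c = image (vertex c)

  ∣vertices∣≤4 : (c : InducedP4 G) → ∣ vertices c ∣ ≤ 4
  ∣vertices∣≤4 c = ∣image∣≤ (vertex c)

  all-∣vertices∣≤4 : (cs : List (InducedP4 G)) → All (λ p → ∣ p ∣ ≤ 4) (map vertices cs)
  all-∣vertices∣≤4 cs = All.map⁺ (All.universal ∣vertices∣≤4 cs)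

  vertices-≅-P4 : (c : InducedP4 G) → sub G (vertices c) ≅ P4
  vertices-≅-P4 c = index , (index-injective , index-surjective) , adj-index
    where
    index : Σ (Fin n) (_∈ vertices c) → Fin 4
    index (_ , v∈) = proj₁ (∈-image⁻ (vertex c) v∈)
    vertex-index : ∀ x → vertex c (index x) ≡ proj₁ x
    vertex-index (_ , v∈) = proj₂ (∈-image⁻ (vertex c) v∈)
    index-injective : Injective _≡_ _≡_ index
    index-injective {u , u∈} {v , v∈} same
      with trans (sym (vertex-index (u , u∈))) (trans (cong (vertex c) same) (vertex-index (v , v∈)))
    ... | refl = cong (u ,_) ([]=-irrelevant u∈ v∈)
    index-surjective : Surjective _≡_ _≡_ index
    index-surjective i = (vertex c i , ∈-image (vertex c) i) , λ { refl → vertex-injective c (vertex-index _) }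
    adj-index : ∀ x y → p4adj (index x) (index y) ≡ adj (sub G (vertices c)) x y
    adj-index x y =
      trans (sym (adj-vertex c (index x) (index y))) (cong₂ (adj G) (vertex-index x) (vertex-index y))

  induced-P4-inside? : {P : Fin n → Set} → Decidable P → Dec (Σ (InducedP4 G) λ c → ∀ i → P (vertex c i))
  induced-P4-inside? {P} P? =
    map′ (λ (e , adj-e , inside) → record { vertex = e ; adj-vertex = adj-e } , inside)
         (λ (c , inside) → vertex c , adj-vertex c , inside)
         (∃-map? resp λ e → all? (λ i → all? λ j → adj G (e i) (e j) Bool.≟ p4adj i j)
                             ×-dec all? (P? ∘ e))
    where
    resp : ∀ {f g} → f ≗ g →
      (∀ i j → adj G (f i) (f j) ≡ p4adj i j) × (∀ i → P (f i)) →
      (∀ i j → adj G (g i) (g j) ≡ p4adj i j) × (∀ i → P (g i))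
    resp f≗g (adj-f , inside) =
      (λ i j → trans (cong₂ (adj G) (sym (f≗g i)) (sym (f≗g j))) (adj-f i j)) ,
      (λ i → subst P (f≗g i) (inside i))

∈⋂⁻ : ∀ {v} (ps : List (Subset n)) → v ∈ ⋂ ps → All (v ∈_) ps
∈⋂⁻ []       _    = []
∈⋂⁻ (p ∷ ps) v∈⋂ = let v∈p , v∈rest = x∈p∩q⁻ p (⋂ ps) v∈⋂ in v∈p ∷ ∈⋂⁻ ps v∈rest

∉⋂⇒avoiding-member : ∀ {v} (σ : A → Subset n) (xs : List A) → v ∉ ⋂ (map σ xs) →
  ∃ λ x → v ∉ σ x × σ x ⊆ ⋃ (map σ xs)
∉⋂⇒avoiding-member σ []       v∉⋂ = contradiction ∈⊤ v∉⋂
∉⋂⇒avoiding-member {v = v} σ (x ∷ xs) v∉⋂ with v ∈? σ x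
... | no  v∉x = x , v∉x , p⊆p∪q _
... | yes v∈x =
  let y , v∉y , y⊆⋃ = ∉⋂⇒avoiding-member σ xs (λ v∈rest → v∉⋂ (x∈p∩q⁺ (v∈x , v∈rest)))
  in  y , v∉y , q⊆p∪q (σ x) _ ∘ y⊆⋃

triple : (xs : List A) → length xs ≡ 3 → ∃ λ a → ∃ λ b → ∃ λ c → xs ≡ a ∷ b ∷ c ∷ []
triple []                    ()
triple (_ ∷ [])              ()
triple (_ ∷ _ ∷ [])          ()
triple (a ∷ b ∷ c ∷ [])      refl = a , b , c , refl
triple (_ ∷ _ ∷ _ ∷ _ ∷ _)   ()

P4Triangle : Graph (Fin n) → Set
P4Triangle {n} G = Σ (Subset n) λ S → Σ (Subset n) λ T → Σ (Subset n) λ F →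
  (S ≢ T × T ≢ F × S ≢ F) ×
  (sub G S ≅ P4 × sub G T ≅ P4 × sub G F ≅ P4) ×
  (∣ S ∩ T ∣ ≡ 1 × ∣ T ∩ F ∣ ≡ 1 × ∣ S ∩ F ∣ ≡ 1)

module _ {G : Graph (Fin n)} (forbidden : IsForbiddenApexCograph G) where

  -- Opaque, as type checking would otherwise unfold the exhaustive search.
  opaque
    avoiding : (v : Fin n) → Σ (InducedP4 G) λ c → v ∉ vertices c
    avoiding v =
      let c , avoids = decidable-stable (induced-P4-inside? (λ u → ¬? (u ≟ v)))
                         (λ none → proj₁ forbidden (inj₂ (v , none ∘ unrestrict)))
      in  c , λ v∈c → let i , vertex≡v = ∈-image⁻ (vertex c) v∈c in avoids i vertex≡v

  avoiders : List (InducedP4 G)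
  avoiders = List.tabulate (proj₁ ∘ avoiding)

  avoiders-share-no-vertex : Empty (⋂ (map vertices avoiders))
  avoiders-share-no-vertex (v , v∈⋂) =
    proj₂ (avoiding v) (All.tabulate⁻ (All.map⁻ (∈⋂⁻ (map vertices avoiders) v∈⋂)) v)

  cover : (cs : List (InducedP4 G)) → Empty (⋂ (map vertices cs)) → ∀ w → w ∈ ⋃ (map vertices cs)
  cover []       empty w = contradiction (w , ∈⊤) empty
  cover (c ∷ cs) empty w with w ∈? ⋃ (map vertices (c ∷ cs))
  ... | yes w∈⋃ = w∈⋃
  ... | no  w∉⋃ = ⊥-elim ([ contains-c , no-apex ]′ (proj₂ forbidden X (w , w∉⋃)))
    where
    X = ⋃ (map vertices (c ∷ cs))
    inside-X : (d : InducedP4 G) → vertices d ⊆ X → InducedP4 (sub G X)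
    inside-X d d⊆X = restrict d (λ i → d⊆X (∈-image (vertex d) i))
    contains-c : ¬ IsCograph (sub G X)
    contains-c cograph = cograph (toHasInducedP4 (inside-X c (p⊆p∪q _)))
    no-apex : ¬ Σ (Σ (Fin n) (_∈ X)) (λ u → IsCograph (delete (sub G X) u))
    no-apex ((u , u∈X) , cograph) =
      let d , u∉d , d⊆X = ∉⋂⇒avoiding-member vertices (c ∷ cs) (λ u∈⋂ → empty (u , u∈⋂))
      in  cograph (toHasInducedP4 (restrict (inside-X d d⊆X)
            (λ i same → u∉d (subst (_∈ vertices d) (cong proj₁ same) (∈-image (vertex d) i)))))

  n≤∣⋃∣ : (cs : List (InducedP4 G)) → Empty (⋂ (map vertices cs)) → n ≤ ∣ ⋃ (map vertices cs) ∣
  n≤∣⋃∣ cs empty =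
    ≤-trans (≤-reflexive (sym (∣⊤∣≡n n))) (p⊆q⇒∣p∣≤∣q∣ {p = ⊤} (λ {w} _ → cover cs empty w))


  9≤∣⋃∣ : 9 ≤ n → (cs : List (InducedP4 G)) → Critical (map vertices cs) → 9 ≤ ∣ ⋃ (map vertices cs) ∣
  9≤∣⋃∣ 9≤n cs (empty , _) = ≤-trans 9≤n (n≤∣⋃∣ cs empty)

  critical-triangle : 9 ≤ n → (cs : List (InducedP4 G)) → Critical (map vertices cs) → P4Triangle G
  critical-triangle 9≤n cs critical
    with triple cs (trans (sym (length-map vertices cs))
                      (critical-length critical (all-∣vertices∣≤4 cs) (9≤∣⋃∣ 9≤n cs critical)))
  ... | a , b , c , refl =
    vertices a , vertices b , vertices c ,
    critical-distinct critical ,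
    (vertices-≅-P4 a , vertices-≅-P4 b , vertices-≅-P4 c) ,
    critical-triple critical (all-∣vertices∣≤4 (a ∷ b ∷ c ∷ []))
      (9≤∣⋃∣ 9≤n (a ∷ b ∷ c ∷ []) critical)

lemma3p2 : (G : Graph (Fin 9)) → IsForbiddenApexCograph G →
    Σ (Subset 9) λ S → Σ (Subset 9) λ T → Σ (Subset 9) λ F →
    (S ≢ T × T ≢ F × S ≢ F) ×
    (sub G S ≅ P4 × sub G T ≅ P4 × sub G F ≅ P4) ×
    (∣ S ∩ T ∣ ≡ 1 × ∣ T ∩ F ∣ ≡ 1 × ∣ S ∩ F ∣ ≡ 1)
lemma3p2 G forbidden =
  let cs , critical = critical-subfamily (vertices {G = G}) (avoiders forbidden)
                        (avoiders-share-no-vertex forbidden)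
  in  critical-triangle forbidden ≤-refl cs critical
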